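{- For every argument filtering function $\pi$, every term $t$ and every substitution $\theta$, $\pi(t\theta{\downarrow})\equiv\pi(t)\theta_\pi{\downarrow}$.
   Context: Setting: HRSs à la Nipkow. Simple types are generated from a set $\mathcal B$ of basic types by $\to$. Terms are simply-typed $\lambda$-terms over typed variables $\mathcal V$ and typed function symbols $\Sigma$ in $\beta$-normal $\eta$-long form, up to $\alpha$-equivalence $\equiv$; $s{\downarrow}$ is the $\beta$-normal $\eta$-long form of a preterm $s$; every term has the form $\lambda x_1\ldots x_m.a(t_1,\ldots,t_n)$ with $a\in\Sigma\cup\mathcal V$. A substitution $\theta$ maps variables to terms of the same type (finite domain), and $t\theta{\downarrow}$ is the normal form of the result of applying it. An argument filtering function $\pi$ assigns to every $f\in\Sigma$ of type $\alpha_1\to\cdots\to\alpha_n\to\beta$ with $\beta\in\mathcal B$ either a positive integer $i\le n$ with $\alpha_i=\beta$, or a list $[i_1,\ldots,i_k]$ of positive integers $\le n$. It is extended to terms by: $\pi(\lambda\vec x.a(t_1,\ldots,t_n))\equiv\lambda\vec x.\pi(t_i)$ if $a\in\Sigma$, $\pi(a)=i$; $\equiv\lambda\vec x.a(\pi(t_{i_1}),\ldots,\pi(t_{i_k}))$ if $a\in\Sigma$, $\pi(a)=[i_1,\ldots,i_k]$; $\equiv\lambda\vec x.a(\pi(t_1),\ldots,\pi(t_n))$ if $a\in\mathcal V$ (filtered terms are typed with $type_\pi(a)=\alpha_{i_1}\to\cdots\to\alpha_{i_k}\to\beta$ when $\pi(a)=[i_1,\ldots,i_k]$, and $type_\pi(a)=type(a)$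 otherwise). For a substitution $\theta$, the substitution $\theta_\pi$ is defined by $\theta_\pi(x)\equiv\pi(\theta(x))$. -}

module Defs where

open import Data.List using (List; []; _∷_; length; map; lookup)
open import Data.Fin using (Fin)
open import Relation.Binary.PropositionalEquality using (_≡_; subst)

infixr 5 _⇒_
data Ty (B : Set) : Set where
  ι   : B → Ty B
  _⇒_ : Ty B → Ty B → Ty B

-- A context lists the (typed) variables that may occur free.
-- Variables are de Bruijn indices, so terms are taken up to α-equivalence.
Ctx : Set → Set
Ctx B = List (Ty B)

data Var {B : Set} : Ctx B → Ty B → Set where
  vz : ∀ {Γ σ} → Var (σ ∷ Γ) σ
  vs : ∀ {Γ σ τ} → Var Γ σ → Var (τ ∷ Γ) σ

_─_ : {B : Set} {σ : Ty B} (Γ : Ctx B) → Var Γ σ → Ctx B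
(_ ∷ Γ) ─ vz   = Γ
(τ ∷ Γ) ─ vs x = τ ∷ (Γ ─ x)

wkv : {B : Set} {Γ : Ctx B} {σ τ : Ty B} (x : Var Γ σ) → Var (Γ ─ x) τ → Var Γ τ
wkv vz     y      = vs y
wkv (vs x) vz     = vz
wkv (vs x) (vs y) = vs (wkv x y)

data EqV {B : Set} {Γ : Ctx B} : {σ τ : Ty B} → Var Γ σ → Var Γ τ → Set where
  same : ∀ {σ} {x : Var Γ σ} → EqV x x
  diff : ∀ {σ τ} (x : Var Γ σ) (y : Var (Γ ─ x) τ) → EqV x (wkv x y)

eqV : {B : Set} {Γ : Ctx B} {σ τ : Ty B} (x : Var Γ σ) (y : Var Γ τ) → EqV x y
eqV vz     vz     = same
eqV vz     (vs y) = diff vz y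
eqV (vs x) vz     = diff (vs x) vz
eqV (vs x) (vs y) with eqV x y
... | same     = same
... | diff .x z = diff (vs x) (vs z)

-- Signatures: each symbol f : α₁ → … → αₙ → β with β basic is given by
-- its argument list [α₁,…,αₙ] and its basic result type β.

record Sig (B : Set) : Set₁ where
  field
    Sym : Set
    ar  : Sym → List (Ty B)
    res : Sym → B

_⇛_ : {B : Set} → List (Ty B) → Ty B → Ty B
[]       ⇛ τ = τ
(σ ∷ As) ⇛ τ = σ ⇒ (As ⇛ τ)

typeOf : {B : Set} (S : Sig B) → Sig.Sym S → Ty B
typeOf S f = Sig.ar S f ⇛ ι (Sig.res S f)

-- Terms in β-normal η-long form:  λx₁…xₘ. a(t₁,…,tₙ),  a ∈ Σ ∪ V,
-- with a applied to all its arguments and the body of basic type.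

module Terms {B : Set} (S : Sig B) where
  open Sig S

  infixr 5 _◂_
  mutual
    data Nf (Γ : Ctx B) : Ty B → Set where
      lam : ∀ {σ τ} → Nf (σ ∷ Γ) τ → Nf Γ (σ ⇒ τ)
      ne  : ∀ {σ b} → Var Γ σ → Sp Γ σ (ι b) → Nf Γ (ι b)
      con : (f : Sym) → Args Γ (ar f) → Nf Γ (ι (res f))

    data Sp (Γ : Ctx B) : Ty B → Ty B → Set where
      ε   : ∀ {σ} → Sp Γ σ σ
      _◂_ : ∀ {σ τ ρ} → Nf Γ σ → Sp Γ τ ρ → Sp Γ (σ ⇒ τ) ρ

    data Args (Γ : Ctx B) : List (Ty B) → Set where
      []  : Args Γ []
      _∷_ : ∀ {σ As} → Nf Γ σ → Args Γ As → Args Γ (σ ∷ As)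

  Ren : Ctx B → Ctx B → Set
  Ren Γ Δ = ∀ {σ} → Var Γ σ → Var Δ σ

  liftR : ∀ {Γ Δ τ} → Ren Γ Δ → Ren (τ ∷ Γ) (τ ∷ Δ)
  liftR r vz     = vz
  liftR r (vs x) = vs (r x)

  mutual
    ren : ∀ {Γ Δ σ} → Ren Γ Δ → Nf Γ σ → Nf Δ σ
    ren r (lam t)    = lam (ren (liftR r) t)
    ren r (ne x sp)  = ne (r x) (renSp r sp)
    ren r (con f as) = con f (renArgs r as)

    renSp : ∀ {Γ Δ σ ρ} → Ren Γ Δ → Sp Γ σ ρ → Sp Δ σ ρ
    renSp r ε        = ε
    renSp r (t ◂ sp) = ren r t ◂ renSp r sp

    renArgs : ∀ {Γ Δ As} → Ren Γ Δ → Args Γ As → Args Δ As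
    renArgs r []       = []
    renArgs r (t ∷ as) = ren r t ∷ renArgs r as

  wk1 : ∀ {Γ σ τ} → Nf Γ σ → Nf (τ ∷ Γ) σ
  wk1 = ren vs

  appendSp : ∀ {Γ ρ σ τ} → Sp Γ ρ (σ ⇒ τ) → Nf Γ σ → Sp Γ ρ τ
  appendSp ε        u = u ◂ ε
  appendSp (v ◂ sp) u = v ◂ appendSp sp u

  ne2nf : ∀ σ {Γ ρ} → Var Γ ρ → Sp Γ ρ σ → Nf Γ σ
  ne2nf (ι b)   x sp = ne x sp
  ne2nf (σ ⇒ τ) x sp = lam (ne2nf τ (vs x) (appendSp (renSp vs sp) (ne2nf σ vz ε)))

  nvar : ∀ {Γ σ} → Var Γ σ → Nf Γ σ
  nvar x = ne2nf _ x ε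

  -- hereditary substitution of a single variable (result is β-normal η-long)
  mutual
    sub : ∀ {Γ σ τ} → Nf Γ τ → (x : Var Γ σ) → Nf (Γ ─ x) σ → Nf (Γ ─ x) τ
    sub (lam t)    x u = lam (sub t (vs x) (wk1 u))
    sub (ne y sp)  x u with eqV x y
    ... | same      = appSp u (subSp sp x u)
    ... | diff .x z = ne z (subSp sp x u)
    sub (con f as) x u = con f (subArgs as x u)

    subSp : ∀ {Γ σ τ ρ} → Sp Γ τ ρ → (x : Var Γ σ) → Nf (Γ ─ x) σ → Sp (Γ ─ x) τ ρ
    subSp ε        x u = ε
    subSp (t ◂ sp) x u = sub t x u ◂ subSp sp x u

    subArgs : ∀ {Γ σ As} → Args Γ As → (x : Var Γ σ) → Nf (Γ ─ x) σ → Args (Γ ─ x) As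
    subArgs []       x u = []
    subArgs (t ∷ as) x u = sub t x u ∷ subArgs as x u

    appSp : ∀ {Γ σ ρ} → Nf Γ σ → Sp Γ σ ρ → Nf Γ ρ
    appSp t ε        = t
    appSp t (u ◂ sp) = appSp (napp t u) sp

    napp : ∀ {Γ σ τ} → Nf Γ (σ ⇒ τ) → Nf Γ σ → Nf Γ τ
    napp (lam t) u = sub t vz u

  -- substitutions: a term for each variable of Γ (variables outside the
  -- domain are mapped to their η-expansion), with free variables in Δ
  Sub : Ctx B → Ctx B → Set
  Sub Γ Δ = ∀ {σ} → Var Γ σ → Nf Δ σ

  liftS : ∀ {Γ Δ τ} → Sub Γ Δ → Sub (τ ∷ Γ) (τ ∷ Δ)
  liftS θ vz     = nvar vz
  liftS θ (vs x) = wk1 (θ x)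

  mutual
    _[_]↓ : ∀ {Γ Δ σ} → Nf Γ σ → Sub Γ Δ → Nf Δ σ
    lam t    [ θ ]↓ = lam (t [ liftS θ ]↓)
    ne x sp  [ θ ]↓ = appSp (θ x) (psubSp sp θ)
    con f as [ θ ]↓ = con f (psubArgs as θ)

    psubSp : ∀ {Γ Δ σ ρ} → Sp Γ σ ρ → Sub Γ Δ → Sp Δ σ ρ
    psubSp ε        θ = ε
    psubSp (t ◂ sp) θ = (t [ θ ]↓) ◂ psubSp sp θ

    psubArgs : ∀ {Γ Δ As} → Args Γ As → Sub Γ Δ → Args Δ As
    psubArgs []       θ = []
    psubArgs (t ∷ as) θ = (t [ θ ]↓) ∷ psubArgs as θ

data Filter {B : Set} (As : List (Ty B)) (b : B) : Set where
  pos : (i : Fin (length As)) → lookup As i ≡ ι b → Filter As b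
  lst : List (Fin (length As)) → Filter As b

ArgFilter : {B : Set} → Sig B → Set
ArgFilter S = (f : Sig.Sym S) → Filter (Sig.ar S f) (Sig.res S f)

-- argument types of type_π(f)  (type_π(f) = type(f) in the `pos` case)
fArgs : {B : Set} {b : B} (As : List (Ty B)) → Filter As b → List (Ty B)
fArgs As (pos i _) = As
fArgs As (lst is)  = map (lookup As) is

filtSig : {B : Set} (S : Sig B) → ArgFilter S → Sig B
filtSig S π = record
  { Sym = Sig.Sym S
  ; ar  = λ f → fArgs (Sig.ar S f) (π f)
  ; res = Sig.res S
  }

module Filtering {B : Set} (S : Sig B) (π : ArgFilter S) where
  module T = Terms S
  module U = Terms (filtSig S π)

  lookupA : ∀ {Γ As} → U.Args Γ As → (i : Fin (length As)) → U.Nf Γ (lookup As i)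
  lookupA (t U.∷ as) Fin.zero    = t
  lookupA (t U.∷ as) (Fin.suc i) = lookupA as i

  selectA : ∀ {Γ As} → U.Args Γ As → (is : List (Fin (length As))) → U.Args Γ (map (lookup As) is)
  selectA as []       = U.[]
  selectA as (i ∷ is) = lookupA as i U.∷ selectA as is

  filtCon : ∀ {Γ As b} (φ : Filter As b) → U.Args Γ As →
            (U.Args Γ (fArgs As φ) → U.Nf Γ (ι b)) → U.Nf Γ (ι b)
  filtCon (pos i p) as k = subst (U.Nf _) p (lookupA as i)
  filtCon (lst is)  as k = k (selectA as is)

  mutual
    filt : ∀ {Γ σ} → T.Nf Γ σ → U.Nf Γ σ
    filt (T.lam t)    = U.lam (filt t)
    filt (T.ne x sp)  = U.ne x (filtSp sp)
    filt (T.con f as) = filtCon (π f) (filtArgs as) (U.con f)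

    filtSp : ∀ {Γ σ ρ} → T.Sp Γ σ ρ → U.Sp Γ σ ρ
    filtSp T.ε        = U.ε
    filtSp (t T.◂ sp) = filt t U.◂ filtSp sp

    filtArgs : ∀ {Γ As} → T.Args Γ As → U.Args Γ As
    filtArgs T.[]       = U.[]
    filtArgs (t T.∷ as) = filt t U.∷ filtArgs as

  filtSub : ∀ {Γ Δ} → T.Sub Γ Δ → U.Sub Γ Δ
  filtSub θ x = filt (θ x)

-- Filtering only deletes or selects arguments of function symbols, and renaming, η-expansion,
-- hereditary substitution and parallel substitution all act argument-wise on a symbol
-- application, so each of them commutes with argument selection. Hence π commutes with each
-- operation in turn, by mutual structural induction mirroring its definition; hereditary
-- substitution and application are handled together, since a variable head replaced by a
-- λ-term triggers new substitutions of the same shape.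
module Submission where

open import Defs
open import Relation.Binary.PropositionalEquality using (_≡_; refl; sym; trans; cong; cong₂; subst)
open import Data.List using (List; []; _∷_; length)
open import Data.Fin using (Fin)

module FilteringCommutes {B : Set} (S : Sig B) (π : ArgFilter S) where
  open Filtering S π

  record Argwise {Γ Δ : Ctx B} (f : ∀ {τ} → U.Nf Γ τ → U.Nf Δ τ)
                 (fA : ∀ {As} → U.Args Γ As → U.Args Δ As) : Set where
    field
      nil  : fA U.[] ≡ U.[]
      cons : ∀ {σ As} (t : U.Nf Γ σ) (as : U.Args Γ As) → fA (t U.∷ as) ≡ f t U.∷ fA as

  module _ {Γ Δ : Ctx B} {f : ∀ {τ} → U.Nf Γ τ → U.Nf Δ τ}
           {fA : ∀ {As} → U.Args Γ As → U.Args Δ As} (hom : Argwise f fA) where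
    open Argwise hom

    lookupA-argwise : ∀ {As} (as : U.Args Γ As) (i : Fin (length As)) →
                      lookupA (fA as) i ≡ f (lookupA as i)
    lookupA-argwise (t U.∷ as) Fin.zero    rewrite cons t as = refl
    lookupA-argwise (t U.∷ as) (Fin.suc i) rewrite cons t as = lookupA-argwise as i

    selectA-argwise : ∀ {As} (as : U.Args Γ As) (is : List (Fin (length As))) →
                      selectA (fA as) is ≡ fA (selectA as is)
    selectA-argwise as []       = sym nil
    selectA-argwise as (i ∷ is) =
      trans (cong₂ U._∷_ (lookupA-argwise as i) (selectA-argwise as is))
            (sym (cons (lookupA as i) (selectA as is)))

    subst-argwise : ∀ {a b : Ty B} (p : a ≡ b) (t : U.Nf Γ a) →
                    f (subst (U.Nf Γ) p t) ≡ subst (U.Nf Δ) p (f t)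
    subst-argwise refl t = refl

    filtCon-argwise : ∀ {As b} (φ : Filter As b) (as : U.Args Γ As)
                      {k : U.Args Γ (fArgs As φ) → U.Nf Γ (ι b)} {k' : U.Args Δ (fArgs As φ) → U.Nf Δ (ι b)} →
                      (∀ xs → f (k xs) ≡ k' (fA xs)) → f (filtCon φ as k) ≡ filtCon φ (fA as) k'
    filtCon-argwise (pos i p) as hk = trans (subst-argwise p (lookupA as i))
                                            (cong (subst (U.Nf _) p) (sym (lookupA-argwise as i)))
    filtCon-argwise (lst is)  as {k' = k'} hk =
      trans (hk (selectA as is)) (cong k' (sym (selectA-argwise as is)))

  ren-argwise : ∀ {Γ Δ} (r : U.Ren Γ Δ) → Argwise (U.ren r) (U.renArgs r)
  ren-argwise r = record { nil = refl ; cons = λ _ _ → refl }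

  sub-argwise : ∀ {Γ σ} (x : Var Γ σ) (u : U.Nf (Γ ─ x) σ) →
                Argwise (λ t → U.sub t x u) (λ as → U.subArgs as x u)
  sub-argwise x u = record { nil = refl ; cons = λ _ _ → refl }

  psub-argwise : ∀ {Γ Δ} (θ : U.Sub Γ Δ) → Argwise (λ t → U._[_]↓ t θ) (λ as → U.psubArgs as θ)
  psub-argwise θ = record { nil = refl ; cons = λ _ _ → refl }

  -- T.liftR and U.liftR agree only pointwise, hence a separate renaming r' on the filtered side.
  _≗ʳ_ : ∀ {Γ Δ} → T.Ren Γ Δ → U.Ren Γ Δ → Set
  _≗ʳ_ {Γ} r r' = ∀ {τ} (x : Var Γ τ) → r x ≡ r' x

  liftR-≗ʳ : ∀ {Γ Δ τ} {r : T.Ren Γ Δ} {r' : U.Ren Γ Δ} → r ≗ʳ r' →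
             T.liftR {τ = τ} r ≗ʳ U.liftR r'
  liftR-≗ʳ hr vz     = refl
  liftR-≗ʳ hr (vs x) = cong vs (hr x)

  mutual
    filt-ren : ∀ {Γ Δ σ} {r : T.Ren Γ Δ} {r' : U.Ren Γ Δ} → r ≗ʳ r' →
               (t : T.Nf Γ σ) → filt (T.ren r t) ≡ U.ren r' (filt t)
    filt-ren hr (T.lam t)   = cong U.lam (filt-ren (liftR-≗ʳ hr) t)
    filt-ren hr (T.ne x sp) = cong₂ U.ne (hr x) (filtSp-ren hr sp)
    filt-ren {r' = r'} hr (T.con g as) =
      trans (cong (λ xs → filtCon (π g) xs (U.con g)) (filtArgs-ren hr as))
            (sym (filtCon-argwise (ren-argwise r') (π g) (filtArgs as) (λ _ → refl)))

    filtSp-ren : ∀ {Γ Δ σ ρ} {r : T.Ren Γ Δ} {r' : U.Ren Γ Δ} → r ≗ʳ r' →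
                 (sp : T.Sp Γ σ ρ) → filtSp (T.renSp r sp) ≡ U.renSp r' (filtSp sp)
    filtSp-ren hr T.ε        = refl
    filtSp-ren hr (t T.◂ sp) = cong₂ U._◂_ (filt-ren hr t) (filtSp-ren hr sp)

    filtArgs-ren : ∀ {Γ Δ As} {r : T.Ren Γ Δ} {r' : U.Ren Γ Δ} → r ≗ʳ r' →
                   (as : T.Args Γ As) → filtArgs (T.renArgs r as) ≡ U.renArgs r' (filtArgs as)
    filtArgs-ren hr T.[]       = refl
    filtArgs-ren hr (t T.∷ as) = cong₂ U._∷_ (filt-ren hr t) (filtArgs-ren hr as)

  filt-wk1 : ∀ {Γ σ τ} (t : T.Nf Γ σ) → filt (T.wk1 {τ = τ} t) ≡ U.wk1 (filt t)
  filt-wk1 = filt-ren (λ _ → refl)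

  filtSp-appendSp : ∀ {Γ ρ σ τ} (sp : T.Sp Γ ρ (σ ⇒ τ)) (u : T.Nf Γ σ) →
                    filtSp (T.appendSp sp u) ≡ U.appendSp (filtSp sp) (filt u)
  filtSp-appendSp T.ε        u = refl
  filtSp-appendSp (v T.◂ sp) u = cong (filt v U.◂_) (filtSp-appendSp sp u)

  filt-ne2nf : ∀ σ {Γ ρ} (x : Var Γ ρ) (sp : T.Sp Γ ρ σ) →
               filt (T.ne2nf σ x sp) ≡ U.ne2nf σ x (filtSp sp)
  filt-ne2nf (ι b)   x sp = refl
  filt-ne2nf (σ ⇒ τ) x sp = cong U.lam (trans (filt-ne2nf τ (vs x) _) (cong (U.ne2nf τ (vs x)) spine))
    where
      spine : filtSp (T.appendSp (T.renSp vs sp) (T.nvar vz))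
              ≡ U.appendSp (U.renSp vs (filtSp sp)) (U.nvar vz)
      spine = trans (filtSp-appendSp (T.renSp vs sp) (T.nvar vz))
                    (cong₂ U.appendSp (filtSp-ren (λ _ → refl) sp) (filt-ne2nf σ vz T.ε))

  mutual
    filt-sub : ∀ {Γ σ τ} (t : T.Nf Γ τ) (x : Var Γ σ) (u : T.Nf (Γ ─ x) σ) →
               filt (T.sub t x u) ≡ U.sub (filt t) x (filt u)
    filt-sub (T.lam t) x u =
      cong U.lam (trans (filt-sub t (vs x) (T.wk1 u)) (cong (U.sub (filt t) (vs x)) (filt-wk1 u)))
    filt-sub (T.ne y sp) x u with eqV x y
    ... | same      = trans (filt-appSp u (T.subSp sp x u)) (cong (U.appSp (filt u)) (filtSp-sub sp x u))
    ... | diff .x z = cong (U.ne z) (filtSp-sub sp x u)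
    filt-sub (T.con g as) x u =
      trans (cong (λ xs → filtCon (π g) xs (U.con g)) (filtArgs-sub as x u))
            (sym (filtCon-argwise (sub-argwise x (filt u)) (π g) (filtArgs as) (λ _ → refl)))

    filtSp-sub : ∀ {Γ σ τ ρ} (sp : T.Sp Γ τ ρ) (x : Var Γ σ) (u : T.Nf (Γ ─ x) σ) →
                 filtSp (T.subSp sp x u) ≡ U.subSp (filtSp sp) x (filt u)
    filtSp-sub T.ε        x u = refl
    filtSp-sub (t T.◂ sp) x u = cong₂ U._◂_ (filt-sub t x u) (filtSp-sub sp x u)

    filtArgs-sub : ∀ {Γ σ As} (as : T.Args Γ As) (x : Var Γ σ) (u : T.Nf (Γ ─ x) σ) →
                   filtArgs (T.subArgs as x u) ≡ U.subArgs (filtArgs as) x (filt u)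
    filtArgs-sub T.[]       x u = refl
    filtArgs-sub (t T.∷ as) x u = cong₂ U._∷_ (filt-sub t x u) (filtArgs-sub as x u)

    filt-appSp : ∀ {Γ σ ρ} (t : T.Nf Γ σ) (sp : T.Sp Γ σ ρ) →
                 filt (T.appSp t sp) ≡ U.appSp (filt t) (filtSp sp)
    filt-appSp t T.ε        = refl
    filt-appSp t (v T.◂ sp) =
      trans (filt-appSp (T.napp t v) sp) (cong (λ s → U.appSp s (filtSp sp)) (filt-napp t v))

    filt-napp : ∀ {Γ σ τ} (t : T.Nf Γ (σ ⇒ τ)) (u : T.Nf Γ σ) →
                filt (T.napp t u) ≡ U.napp (filt t) (filt u)
    filt-napp (T.lam t) u = filt-sub t vz u

  -- Likewise T.liftS θ and U.liftS (filtSub θ) agree only up to filt-ne2nf on the new variable.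
  _≗ˢ_ : ∀ {Γ Δ} → U.Sub Γ Δ → U.Sub Γ Δ → Set
  _≗ˢ_ {Γ} θ θ' = ∀ {τ} (x : Var Γ τ) → θ x ≡ θ' x

  filtSub-liftS : ∀ {Γ Δ τ} {θ : T.Sub Γ Δ} {θ' : U.Sub Γ Δ} → filtSub θ ≗ˢ θ' →
                  filtSub (T.liftS {τ = τ} θ) ≗ˢ U.liftS θ'
  filtSub-liftS hθ vz     = filt-ne2nf _ vz T.ε
  filtSub-liftS {θ = θ} hθ (vs x) = trans (filt-wk1 (θ x)) (cong U.wk1 (hθ x))

  mutual
    filt-[]↓ : ∀ {Γ Δ σ} (t : T.Nf Γ σ) {θ : T.Sub Γ Δ} {θ' : U.Sub Γ Δ} → filtSub θ ≗ˢ θ' →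
               filt (T._[_]↓ t θ) ≡ U._[_]↓ (filt t) θ'
    filt-[]↓ (T.lam t) hθ = cong U.lam (filt-[]↓ t (filtSub-liftS hθ))
    filt-[]↓ (T.ne x sp) {θ} hθ =
      trans (filt-appSp (θ x) (T.psubSp sp θ)) (cong₂ U.appSp (hθ x) (filtSp-psubSp sp hθ))
    filt-[]↓ (T.con g as) {θ' = θ'} hθ =
      trans (cong (λ xs → filtCon (π g) xs (U.con g)) (filtArgs-psubArgs as hθ))
            (sym (filtCon-argwise (psub-argwise θ') (π g) (filtArgs as) (λ _ → refl)))

    filtSp-psubSp : ∀ {Γ Δ σ ρ} (sp : T.Sp Γ σ ρ) {θ : T.Sub Γ Δ} {θ' : U.Sub Γ Δ} →
                    filtSub θ ≗ˢ θ' → filtSp (T.psubSp sp θ) ≡ U.psubSp (filtSp sp) θ'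
    filtSp-psubSp T.ε        hθ = refl
    filtSp-psubSp (t T.◂ sp) hθ = cong₂ U._◂_ (filt-[]↓ t hθ) (filtSp-psubSp sp hθ)

    filtArgs-psubArgs : ∀ {Γ Δ As} (as : T.Args Γ As) {θ : T.Sub Γ Δ} {θ' : U.Sub Γ Δ} →
                        filtSub θ ≗ˢ θ' → filtArgs (T.psubArgs as θ) ≡ U.psubArgs (filtArgs as) θ'
    filtArgs-psubArgs T.[]       hθ = refl
    filtArgs-psubArgs (t T.∷ as) hθ = cong₂ U._∷_ (filt-[]↓ t hθ) (filtArgs-psubArgs as hθ)

lemma3 : {B : Set} (S : Sig B) (π : ArgFilter S) {Γ Δ : Ctx B} {σ : Ty B}
         (t : Terms.Nf S Γ σ) (θ : Terms.Sub S Γ Δ) →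
         Filtering.filt S π (Terms._[_]↓ S t θ)
           ≡ Terms._[_]↓ (filtSig S π) (Filtering.filt S π t) (Filtering.filtSub S π θ)
lemma3 S π t θ = FilteringCommutes.filt-[]↓ S π t (λ _ → refl)
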